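{- Let $N$ be a matroid with at least two elements that has the transitivity property. Then $N$ has a connected component with more than one element.
   Context: An $N$-minor is a minor isomorphic to $N$; it uses $Z$ if its ground set contains $Z$. A matroid $N$ has the transitivity property if, for every matroid $M$ and every set $\{e,f,g\} \subseteq E(M)$ of three distinct elements, whenever $M$ has an $N$-minor using $\{e,f\}$ and an $N$-minor using $\{f,g\}$, it also has an $N$-minor using $\{e,g\}$. -}

module Defs where

open import Data.Nat using (ℕ; _<_)
open import Data.Fin using (Fin; _≟_)
open import Data.Fin.Properties using (any?)
open import Data.Fin.Subset using (Subset; _∈_; _∉_; _⊆_; _∪_; ⁅_⁆; ⊥; ∣_∣; _-_)
open import Data.Fin.Subset.Properties using (_∈?_)
open import Data.Vec using (tabulate)
open import Data.Sum using (_⊎_)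
open import Data.Product using (Σ; ∃; ∃-syntax; _×_; _,_)
open import Relation.Nullary using (¬_; Dec; does)
open import Relation.Nullary.Decidable using (_×-dec_)
open import Relation.Unary using (Decidable)
open import Relation.Binary.PropositionalEquality using (_≡_; _≢_)
open import Function.Definitions using (Injective)
open import Function.Bundles using (_⇔_)

-- Independence is decidable,
-- as is automatic for a finite matroid given as finite data.
record Matroid (n : ℕ) : Set₁ where
  field
    Indep      : Subset n → Set
    indep?     : Decidable Indep
    indep-∅    : Indep ⊥
    indep-↓    : ∀ {X Y} → Y ⊆ X → Indep X → Indep Y
    indep-aug  : ∀ {X Y} → Indep X → Indep Y → ∣ X ∣ < ∣ Y ∣ →
                 ∃[ e ] (e ∈ Y × e ∉ X × Indep (⁅ e ⁆ ∪ X))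

open Matroid public

IsCircuit : ∀ {n} → Matroid n → Subset n → Set
IsCircuit M C = ¬ Indep M C × (∀ e → e ∈ C → Indep M (C - e))

SameComponent : ∀ {n} → Matroid n → Fin n → Fin n → Set
SameComponent M e f = e ≡ f ⊎ (∃[ C ] (IsCircuit M C × e ∈ C × f ∈ C))

HasNontrivialComponent : ∀ {n} → Matroid n → Set
HasNontrivialComponent {n} M =
  ∃[ e ] ∃[ f ] (e ≢ f × SameComponent M e f)

IsBasisOf : ∀ {n} → Matroid n → Subset n → Subset n → Set
IsBasisOf M B C =
  B ⊆ C × Indep M B × (∀ e → e ∈ C → e ∉ B → ¬ Indep M (⁅ e ⁆ ∪ B))

-- X is independent in the contraction M / C
IndepContr : ∀ {n} → Matroid n → Subset n → Subset n → Set
IndepContr M C X =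
  (∀ e → e ∈ X → e ∉ C) × (∃[ B ] (IsBasisOf M B C × Indep M (X ∪ B)))

image : ∀ {k m} → (Fin k → Fin m) → Subset k → Subset m
image φ X = tabulate (λ y → does (any? (λ x → (x ∈? X) ×-dec (φ x ≟ y))))

-- M has an N-minor (a minor M / C \ D isomorphic to N) whose ground set
-- E(M) − (C ∪ D) contains e and f.  The isomorphism is a bijection
-- φ : E(N) → E(M) − (C ∪ D) preserving independence.
HasMinorUsing : ∀ {k m} → Matroid k → Matroid m → Fin m → Fin m → Set
HasMinorUsing {k} {m} N M e f =
  Σ (Subset m) λ C → Σ (Subset m) λ D → Σ (Fin k → Fin m) λ φ →
    (∀ y → y ∈ C → y ∉ D)
    × Injective _≡_ _≡_ φ
    × (∀ x → φ x ∉ C × φ x ∉ D)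
    × (∀ y → y ∉ C → y ∉ D → ∃[ x ] (φ x ≡ y))
    × (∀ X → (Indep N X ⇔ IndepContr M C (image φ X)))
    × (e ∉ C × e ∉ D) × (f ∉ C × f ∉ D)

HasTransitivity : ∀ {k} → Matroid k → Set₁
HasTransitivity N =
  ∀ {m} (M : Matroid m) (e f g : Fin m) →
  e ≢ f → f ≢ g → e ≢ g →
  HasMinorUsing N M e f → HasMinorUsing N M f g → HasMinorUsing N M e g

-- If some element e of N is neither a loop nor a coloop, then a circuit through e
-- contains a second element.  Otherwise element 0 is a loop or a coloop, and N is
-- N∖0 together with a one-element component.  Put M = U₁,₂ ⊕ (N∖0), whose
-- elements 0 and 1 form a parallel pair: keeping one of them in place of the
-- element 0 of N and deleting (coloop case) or contracting (loop case) the other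
-- gives N-minors of M using {1, 2} and {2, 0}.  Transitivity yields an N-minor
-- using {1, 0}, and in it the parallel pair survives as a two-element circuit of N.
module Submission where

open import Defs
open import Data.Bool using (_∧_)
open import Data.Bool.Properties using (∧-identityʳ; ∧-zeroʳ) renaming (_≟_ to _≟ᵇ_)
open import Data.Empty using (⊥-elim)
open import Data.Fin using (Fin; zero; suc; _≟_; punchIn; punchOut; _↑ˡ_)
open import Data.Fin.Properties using (any?; punchIn-injective; punchInᵢ≢i; punchIn-punchOut)
open import Data.Fin.Subset
open import Data.Fin.Subset.Properties
open import Data.Nat using (zero; suc; _+_; _≤_; _<_; s≤s; z≤n; _<?_)
open import Data.Nat.Properties using (≤-trans; ≤-refl; ≤-pred; n≤1+n; n≮0)
open import Data.Product using (∃-syntax; _×_; _,_; proj₁; proj₂)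
open import Data.Product.Function.NonDependent.Propositional using (_×-⇔_)
open import Data.Sum using (_⊎_; inj₁; inj₂)
open import Data.Vec.Base using (_∷_; lookup; here; there)
open import Data.Vec.Properties using ([]=⇒lookup; lookup⇒[]=; lookup∘tabulate)
open import Function.Bundles using (_⇔_; mk⇔; Equivalence)
open import Function.Construct.Composition using (_⇔-∘_)
open import Function.Construct.Identity using (⇔-id)
open import Function.Construct.Symmetry using (⇔-sym)
open import Relation.Nullary using (¬_; Dec; does; yes; no)
open import Relation.Nullary.Decidable using (_×-dec_; ¬?; dec-true; decidable-stable)
open import Relation.Binary.PropositionalEquality using (_≡_; _≢_; refl; sym; trans; cong; subst)

open Equivalence using (to; from)

∪-least : ∀ {n} {p q r : Subset n} → p ⊆ r → q ⊆ r → p ∪ q ⊆ r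
∪-least {p = p} {q} p⊆r q⊆r x∈ with x∈p∪q⁻ p q x∈
... | inj₁ x∈p = p⊆r x∈p
... | inj₂ x∈q = q⊆r x∈q

⁅x⁆⊆p : ∀ {n} {x : Fin n} {p} → x ∈ p → ⁅ x ⁆ ⊆ p
⁅x⁆⊆p {x = x} x∈p y∈ = subst (_∈ _) (sym (x∈⁅y⁆⇒x≡y x y∈)) x∈p

x∈p─q⇒x∉q : ∀ {n} {x : Fin n} (p q : Subset n) → x ∈ p ─ q → x ∉ q
x∈p─q⇒x∉q (_ ∷ _) (inside ∷ _) () here
x∈p─q⇒x∉q (_ ∷ _) (outside ∷ _) here ()
x∈p─q⇒x∉q (_ ∷ p) (_ ∷ q) (there x∈) (there x∈q) = x∈p─q⇒x∉q p q x∈ x∈q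

⁅x⁆∪q-x⊆q : ∀ {n} (x : Fin n) q → ⁅ x ⁆ ∪ q - x ⊆ q
⁅x⁆∪q-x⊆q x q y∈ with x∈p∪q⁻ ⁅ x ⁆ q (p─q⊆p (⁅ x ⁆ ∪ q) ⁅ x ⁆ y∈)
... | inj₁ y∈⁅x⁆ = ⊥-elim (x∈p─q⇒x∉q (⁅ x ⁆ ∪ q) ⁅ x ⁆ y∈ y∈⁅x⁆)
... | inj₂ y∈q = y∈q

module _ {k m} {φ : Fin k → Fin m} {X : Subset k} where

  private
    preimage? : ∀ y → Dec (∃[ x ] (x ∈ X × φ x ≡ y))
    preimage? y = any? (λ x → (x ∈? X) ×-dec (φ x ≟ y))

    lookup-image : ∀ y → lookup (image φ X) y ≡ does (preimage? y)
    lookup-image = lookup∘tabulate _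

  ∈-image⁻ : ∀ {y} → y ∈ image φ X → ∃[ x ] (x ∈ X × φ x ≡ y)
  ∈-image⁻ {y} y∈ with preimage? y | trans (sym (lookup-image y)) ([]=⇒lookup y∈)
  ... | yes found | _ = found
  ... | no _ | ()

  ∈-image⁺ : ∀ {x} → x ∈ X → φ x ∈ image φ X
  ∈-image⁺ {x} x∈ =
    lookup⇒[]= (φ x) (image φ X)
      (trans (lookup-image (φ x)) (dec-true (preimage? (φ x)) (x , x∈ , refl)))

image-⁅⁆ : ∀ {k m} (φ : Fin k → Fin m) x → image φ ⁅ x ⁆ ⊆ ⁅ φ x ⁆
image-⁅⁆ φ x y∈ with ∈-image⁻ {φ = φ} y∈
... | x′ , x′∈ , refl = subst (λ z → φ z ∈ ⁅ φ x ⁆) (sym (x∈⁅y⁆⇒x≡y x x′∈)) (x∈⁅x⁆ (φ x))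

image-punchIn-zero : ∀ {m} (X : Subset m) → image (punchIn zero) X ≡ outside ∷ X
image-punchIn-zero X = ⊆-antisym image⊆ ⊆image
  where
  image⊆ : image (punchIn zero) X ⊆ outside ∷ X
  image⊆ y∈ with ∈-image⁻ {φ = punchIn zero} y∈
  ... | _ , x∈ , refl = there x∈
  ⊆image : outside ∷ X ⊆ image (punchIn zero) X
  ⊆image (there x∈) = ∈-image⁺ x∈

image-punchIn-suc : ∀ {m} (i : Fin (suc m)) c (X : Subset m) →
                    image (punchIn (suc i)) (c ∷ X) ≡ c ∷ image (punchIn i) X
image-punchIn-suc i c X = ⊆-antisym image⊆ ⊆image
  where
  image⊆ : image (punchIn (suc i)) (c ∷ X) ⊆ c ∷ image (punchIn i) X
  image⊆ y∈ with ∈-image⁻ {φ = punchIn (suc i)} y∈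
  ... | zero , here , refl = here
  ... | suc _ , there x∈ , refl = there (∈-image⁺ x∈)
  ⊆image : c ∷ image (punchIn i) X ⊆ image (punchIn (suc i)) (c ∷ X)
  ⊆image here = ∈-image⁺ {φ = punchIn (suc i)} {X = c ∷ X} {x = zero} here
  ⊆image (there y∈) with ∈-image⁻ {φ = punchIn i} y∈
  ... | x , x∈ , refl = ∈-image⁺ {φ = punchIn (suc i)} {X = c ∷ X} {x = suc x} (there x∈)

IsLoop : ∀ {n} → Matroid n → Fin n → Set
IsLoop M e = ¬ Indep M ⁅ e ⁆

IsColoop : ∀ {n} → Matroid n → Fin n → Set
IsColoop M e = ∀ I → Indep M I → Indep M (⁅ e ⁆ ∪ I)

IsColoopOfDeletion : ∀ {n} → Matroid n → Fin n → Fin n → Set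
IsColoopOfDeletion M d e = ∀ I → d ∉ I → Indep M I → Indep M (⁅ e ⁆ ∪ I)

module _ {n} (M : Matroid n) where

  dependent⇒circuit : ∀ {X} → ¬ Indep M X → ∃[ C ] (C ⊆ X × IsCircuit M C)
  dependent⇒circuit {X} = search ∣ X ∣ X ≤-refl
    where
    search : ∀ t Y → ∣ Y ∣ ≤ t → ¬ Indep M Y → ∃[ C ] (C ⊆ Y × IsCircuit M C)
    search zero Y ∣Y∣≤0 dep = ⊥-elim (dep (subst (Indep M) (sym (Empty-unique empty)) (indep-∅ M)))
      where
      empty : Empty Y
      empty (_ , x∈) = n≮0 (≤-trans (x∈p⇒∣p-x∣<∣p∣ x∈) ∣Y∣≤0)
    search (suc t) Y ∣Y∣≤ dep with any? (λ e → (e ∈? Y) ×-dec ¬? (indep? M (Y - e)))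
    ... | yes (e , e∈ , dep-e) with search t (Y - e) (≤-pred (≤-trans (x∈p⇒∣p-x∣<∣p∣ e∈) ∣Y∣≤)) dep-e
    ...   | C , C⊆ , circuit = C , (λ x∈ → p─q⊆p Y ⁅ e ⁆ (C⊆ x∈)) , circuit
    search (suc t) Y _ dep | no ∄ =
      Y , (λ x∈ → x∈) , dep , λ e e∈ → decidable-stable (indep? M (Y - e)) (λ dep-e → ∄ (e , e∈ , dep-e))

  indep-pair⇒circuit : ∀ {x y} → Indep M ⁅ x ⁆ → Indep M ⁅ y ⁆ → ¬ Indep M (⁅ x ⁆ ∪ ⁅ y ⁆) →
                       IsCircuit M (⁅ x ⁆ ∪ ⁅ y ⁆)
  indep-pair⇒circuit {x} {y} x-indep y-indep dep = dep , drop
    where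
    drop : ∀ e → e ∈ ⁅ x ⁆ ∪ ⁅ y ⁆ → Indep M (⁅ x ⁆ ∪ ⁅ y ⁆ - e)
    drop e e∈ with x∈p∪q⁻ ⁅ x ⁆ ⁅ y ⁆ e∈
    ... | inj₁ e∈⁅x⁆ rewrite x∈⁅y⁆⇒x≡y x e∈⁅x⁆ = indep-↓ M (⁅x⁆∪q-x⊆q x ⁅ y ⁆) y-indep
    ... | inj₂ e∈⁅y⁆ rewrite x∈⁅y⁆⇒x≡y y e∈⁅y⁆ | ∪-comm ⁅ x ⁆ ⁅ y ⁆ =
      indep-↓ M (⁅x⁆∪q-x⊆q y ⁅ x ⁆) x-indep

  nonLoop-nonColoop⇒nontrivial : ∀ {e I} → Indep M ⁅ e ⁆ → Indep M I → ¬ Indep M (⁅ e ⁆ ∪ I) →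
                                 ∃[ f ] (e ≢ f × SameComponent M e f)
  nonLoop-nonColoop⇒nontrivial {e} {I} e-indep I-indep dep with dependent⇒circuit dep
  ... | C , C⊆ , circuit@(C-dep , _) with e ∈? C
  ...   | no e∉C = ⊥-elim (C-dep (indep-↓ M C⊆I I-indep))
    where
    C⊆I : C ⊆ I
    C⊆I x∈ with x∈p∪q⁻ ⁅ e ⁆ I (C⊆ x∈)
    ... | inj₁ x∈⁅e⁆ = ⊥-elim (e∉C (subst (_∈ C) (x∈⁅y⁆⇒x≡y e x∈⁅e⁆) x∈))
    ... | inj₂ x∈I = x∈I
  ...   | yes e∈C with any? (λ f → (f ∈? C) ×-dec ¬? (e ≟ f))
  ...     | yes (f , f∈C , e≢f) = f , e≢f , inj₂ (C , circuit , e∈C , f∈C)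
  ...     | no ∄ = ⊥-elim (C-dep (indep-↓ M C⊆⁅e⁆ e-indep))
    where
    C⊆⁅e⁆ : C ⊆ ⁅ e ⁆
    C⊆⁅e⁆ {x} x∈ with e ≟ x
    ... | yes refl = x∈⁅x⁆ e
    ... | no e≢x = ⊥-elim (∄ (x , x∈ , e≢x))

  loop⊎coloop⊎nontrivial : ∀ e → (IsLoop M e ⊎ IsColoop M e) ⊎ HasNontrivialComponent M
  loop⊎coloop⊎nontrivial e with indep? M ⁅ e ⁆
  ... | no loop = inj₁ (inj₁ loop)
  ... | yes e-indep with anySubset? (λ I → indep? M I ×-dec ¬? (indep? M (⁅ e ⁆ ∪ I)))
  ...   | yes (I , I-indep , dep) = inj₂ (e , nonLoop-nonColoop⇒nontrivial e-indep I-indep dep)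
  ...   | no ∄ = inj₁ (inj₂ λ I I-indep →
            decidable-stable (indep? M (⁅ e ⁆ ∪ I)) (λ dep → ∄ (I , I-indep , dep)))

  indepContr-⊥ : ∀ {Z} → IndepContr M ⊥ Z ⇔ Indep M Z
  indepContr-⊥ {Z} = mk⇔ contracted⇒ ⇒contracted
    where
    contracted⇒ : IndepContr M ⊥ Z → Indep M Z
    contracted⇒ (_ , B , _ , indep) = indep-↓ M (p⊆p∪q B) indep
    ⇒contracted : Indep M Z → IndepContr M ⊥ Z
    ⇒contracted Z-indep =
      (λ _ _ → ∉⊥) , ⊥ , ((λ x∈ → x∈) , indep-∅ M , λ _ e∈⊥ → ⊥-elim (∉⊥ e∈⊥)) ,
      subst (Indep M) (sym (∪-identityʳ Z)) Z-indep

  indepContr-⁅⁆ : ∀ {h Z} → Indep M ⁅ h ⁆ → h ∉ Z → IndepContr M ⁅ h ⁆ Z ⇔ Indep M (⁅ h ⁆ ∪ Z)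
  indepContr-⁅⁆ {h} {Z} h-indep h∉Z = mk⇔ contracted⇒ ⇒contracted
    where
    contracted⇒ : IndepContr M ⁅ h ⁆ Z → Indep M (⁅ h ⁆ ∪ Z)
    contracted⇒ (_ , B , (B⊆ , _ , maximal) , indep) with h ∈? B
    ... | yes h∈B = indep-↓ M (∪-least (⁅x⁆⊆p (q⊆p∪q Z B h∈B)) (p⊆p∪q B)) indep
    ... | no h∉B = ⊥-elim (maximal h (x∈⁅x⁆ h) h∉B (indep-↓ M (∪-least ⊆-refl B⊆) h-indep))
    ⇒contracted : Indep M (⁅ h ⁆ ∪ Z) → IndepContr M ⁅ h ⁆ Z
    ⇒contracted indep =
      (λ e e∈Z e∈⁅h⁆ → h∉Z (subst (_∈ Z) (x∈⁅y⁆⇒x≡y h e∈⁅h⁆) e∈Z)) ,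
      ⁅ h ⁆ , ((λ x∈ → x∈) , h-indep , λ _ e∈ e∉ → ⊥-elim (e∉ e∈)) ,
      subst (Indep M) (∪-comm ⁅ h ⁆ Z) indep

module _ {k} (N : Matroid k) (M : Matroid (suc k)) (h : Fin (suc k)) where

  private
    punchIn∉⁅h⁆ : ∀ x → punchIn h x ∉ ⁅ h ⁆
    punchIn∉⁅h⁆ x = x≢y⇒x∉⁅y⁆ (punchInᵢ≢i h x)

    punchIn-covers : ∀ y → y ∉ ⁅ h ⁆ → ∃[ x ] (punchIn h x ≡ y)
    punchIn-covers y y∉ = punchOut h≢y , punchIn-punchOut h≢y
      where
      h≢y : h ≢ y
      h≢y h≡y = x∉⁅y⁆⇒x≢y y∉ (sym h≡y)

    h∉image : ∀ X → h ∉ image (punchIn h) X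
    h∉image X h∈ with ∈-image⁻ {φ = punchIn h} h∈
    ... | x , _ , eq = punchInᵢ≢i h x eq

  minor-deleting : (∀ X → Indep N X ⇔ Indep M (image (punchIn h) X)) →
                   ∀ x y → HasMinorUsing N M (punchIn h x) (punchIn h y)
  minor-deleting iso x y =
    ⊥ , ⁅ h ⁆ , punchIn h , (λ _ y∈⊥ → ⊥-elim (∉⊥ y∈⊥)) , (λ {x′} {y′} → punchIn-injective h x′ y′) ,
    (λ z → ∉⊥ , punchIn∉⁅h⁆ z) , (λ z _ → punchIn-covers z) ,
    (λ X → ⇔-sym (indepContr-⊥ M) ⇔-∘ iso X) , (∉⊥ , punchIn∉⁅h⁆ x) , (∉⊥ , punchIn∉⁅h⁆ y)

  minor-contracting : Indep M ⁅ h ⁆ → (∀ X → Indep N X ⇔ Indep M (⁅ h ⁆ ∪ image (punchIn h) X)) →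
                      ∀ x y → HasMinorUsing N M (punchIn h x) (punchIn h y)
  minor-contracting h-indep iso x y =
    ⁅ h ⁆ , ⊥ , punchIn h , (λ _ _ → ∉⊥) , (λ {x′} {y′} → punchIn-injective h x′ y′) ,
    (λ z → punchIn∉⁅h⁆ z , ∉⊥) , (λ z z∉ _ → punchIn-covers z z∉) ,
    (λ X → ⇔-sym (indepContr-⁅⁆ M h-indep (h∉image X)) ⇔-∘ iso X) ,
    (punchIn∉⁅h⁆ x , ∉⊥) , (punchIn∉⁅h⁆ y , ∉⊥)

-- The preimages of a and b form a circuit of N: dependence is reflected by any
-- minor, and neither is a loop because a basis of C avoids both a and b.
minor-using-parallel-pair : ∀ {k m} {N : Matroid k} {M : Matroid m} {a b} → a ≢ b →
  ¬ Indep M (⁅ a ⁆ ∪ ⁅ b ⁆) → IsColoopOfDeletion M b a → IsColoopOfDeletion M a b →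
  HasMinorUsing N M a b → HasNontrivialComponent N
minor-using-parallel-pair {N = N} {M} {a} {b} a≢b ab-dep a-free b-free
  (C , D , φ , _ , _ , avoids , covers , iso , (a∉C , a∉D) , (b∉C , b∉D))
  with covers a a∉C a∉D | covers b b∉C b∉D
... | x , refl | y , refl =
  x , y , (λ x≡y → a≢b (cong φ x≡y)) ,
  inj₂ (⁅ x ⁆ ∪ ⁅ y ⁆ ,
        indep-pair⇒circuit N (nonLoop b∉C a-free) (nonLoop a∉C b-free) xy-dep ,
        p⊆p∪q ⁅ y ⁆ (x∈⁅x⁆ x) , q⊆p∪q ⁅ x ⁆ ⁅ y ⁆ (x∈⁅x⁆ y))
  where
  image-avoids-C : ∀ X z → z ∈ image φ X → z ∉ C
  image-avoids-C X z z∈ with ∈-image⁻ {φ = φ} z∈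
  ... | w , _ , refl = proj₁ (avoids w)

  xy-dep : ¬ Indep N (⁅ x ⁆ ∪ ⁅ y ⁆)
  xy-dep xy-indep with to (iso (⁅ x ⁆ ∪ ⁅ y ⁆)) xy-indep
  ... | _ , B , _ , indep = ab-dep (indep-↓ M ab⊆ indep)
    where
    ab⊆ : ⁅ φ x ⁆ ∪ ⁅ φ y ⁆ ⊆ image φ (⁅ x ⁆ ∪ ⁅ y ⁆) ∪ B
    ab⊆ = ∪-least (⁅x⁆⊆p (p⊆p∪q B (∈-image⁺ (p⊆p∪q ⁅ y ⁆ (x∈⁅x⁆ x)))))
                  (⁅x⁆⊆p (p⊆p∪q B (∈-image⁺ (q⊆p∪q ⁅ x ⁆ ⁅ y ⁆ (x∈⁅x⁆ y)))))

  nonLoop : ∀ {d z} → d ∉ C → IsColoopOfDeletion M d (φ z) → Indep N ⁅ z ⁆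
  nonLoop {d} {z} d∉C free with to (iso ⊥) (indep-∅ N)
  ... | _ , B , basis@(B⊆C , B-indep , _) , _ =
    from (iso ⁅ z ⁆) (image-avoids-C ⁅ z ⁆ , B , basis ,
      indep-↓ M (∪-least (λ w∈ → p⊆p∪q B (image-⁅⁆ φ z w∈)) (q⊆p∪q ⁅ φ z ⁆ B))
                (free B (λ d∈B → d∉C (B⊆C d∈B)) B-indep))

deleteZero : ∀ {n} → Matroid (suc n) → Matroid n
deleteZero {n} N = record
  { Indep = λ X → Indep N (outside ∷ X)
  ; indep? = λ X → indep? N (outside ∷ X)
  ; indep-∅ = indep-∅ N
  ; indep-↓ = λ Y⊆X → indep-↓ N (out⊆ Y⊆X)
  ; indep-aug = augment
  }
  where
  augment : ∀ {X Y : Subset n} → Indep N (outside ∷ X) → Indep N (outside ∷ Y) → ∣ X ∣ < ∣ Y ∣ →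
            ∃[ e ] (e ∈ Y × e ∉ X × Indep N (outside ∷ (⁅ e ⁆ ∪ X)))
  augment X-indep Y-indep X<Y with indep-aug N X-indep Y-indep X<Y
  ... | suc e , there e∈Y , e∉X , indep = e , e∈Y , (λ e∈X → e∉X (there e∈X)) , indep

-- The matroid U₁,₂ ⊕ K: the new elements 0 and 1 form a parallel pair.
parallelPair⊕ : ∀ {n} → Matroid n → Matroid (2 + n)
parallelPair⊕ {n} K = record
  { Indep = Indep′
  ; indep? = λ { (b ∷ c ∷ X) → ((b ∧ c) ≟ᵇ outside) ×-dec indep? K X }
  ; indep-∅ = refl , indep-∅ K
  ; indep-↓ = indep-↓′
  ; indep-aug = augment
  }
  where
  Indep′ : Subset (2 + n) → Set
  Indep′ (b ∷ c ∷ X) = b ∧ c ≡ outside × Indep K X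

  pair-↓ : ∀ {b c b′ c′} {P Q : Subset n} → b′ ∷ c′ ∷ Q ⊆ b ∷ c ∷ P →
           b ∧ c ≡ outside → b′ ∧ c′ ≡ outside
  pair-↓ {b′ = outside} _ _ = refl
  pair-↓ {b′ = inside} {c′ = outside} _ _ = refl
  pair-↓ {b′ = inside} {c′ = inside} sub ok with sub here | sub (there here)
  ... | here | there here = ok

  indep-↓′ : ∀ {X Y} → Y ⊆ X → Indep′ X → Indep′ Y
  indep-↓′ {_ ∷ _ ∷ _} {_ ∷ _ ∷ _} Y⊆X (ok , indep) =
    pair-↓ Y⊆X ok , indep-↓ K (drop-∷-⊆ (drop-∷-⊆ Y⊆X)) indep

  pair-size≤ : ∀ b c (Q : Subset n) → b ∧ c ≡ outside → ∣ b ∷ c ∷ Q ∣ ≤ suc ∣ Q ∣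
  pair-size≤ inside outside _ _ = ≤-refl
  pair-size≤ outside inside _ _ = ≤-refl
  pair-size≤ outside outside Q _ = n≤1+n ∣ Q ∣

  augment : ∀ {X Y} → Indep′ X → Indep′ Y → ∣ X ∣ < ∣ Y ∣ →
            ∃[ e ] (e ∈ Y × e ∉ X × Indep′ (⁅ e ⁆ ∪ X))
  augment {b ∷ c ∷ P} {_ ∷ _ ∷ Q} (ok , P-indep) (_ , Q-indep) _ with ∣ P ∣ <? ∣ Q ∣
  ... | yes P<Q with indep-aug K P-indep Q-indep P<Q
  ...   | e , e∈Q , e∉P , indep =
    suc (suc e) , there (there e∈Q) , (λ { (there (there e∈P)) → e∉P e∈P }) , ok , indep
  augment {outside ∷ outside ∷ P} {inside ∷ _ ∷ _} (_ , P-indep) _ _ | no _ =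
    zero , here , (λ ()) , refl , subst (Indep K) (sym (∪-identityˡ P)) P-indep
  augment {outside ∷ outside ∷ P} {outside ∷ inside ∷ _} (_ , P-indep) _ _ | no _ =
    suc zero , there here , (λ { (there ()) }) , refl , subst (Indep K) (sym (∪-identityˡ P)) P-indep
  augment {outside ∷ outside ∷ _} {outside ∷ outside ∷ _} _ _ X<Y | no P≮Q = ⊥-elim (P≮Q X<Y)
  augment {inside ∷ outside ∷ _} {b′ ∷ c′ ∷ Q} _ (ok , _) X<Y | no P≮Q =
    ⊥-elim (P≮Q (≤-pred (≤-trans X<Y (pair-size≤ b′ c′ Q ok))))
  augment {outside ∷ inside ∷ _} {b′ ∷ c′ ∷ Q} _ (ok , _) X<Y | no P≮Q =
    ⊥-elim (P≮Q (≤-pred (≤-trans X<Y (pair-size≤ b′ c′ Q ok))))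

module _ {n} (K : Matroid n) where

  private
    M : Matroid (2 + n)
    M = parallelPair⊕ K

  parallelPair-dependent : ¬ Indep M (⁅ suc zero ⁆ ∪ ⁅ zero ⁆)
  parallelPair-dependent (() , _)

  parallelPair-coloop₀ : IsColoopOfDeletion M (suc zero) zero
  parallelPair-coloop₀ (_ ∷ inside ∷ _) 1∉I _ = ⊥-elim (1∉I (there here))
  parallelPair-coloop₀ (_ ∷ outside ∷ I) _ (_ , I-indep) =
    refl , subst (Indep K) (sym (∪-identityˡ I)) I-indep

  parallelPair-coloop₁ : IsColoopOfDeletion M zero (suc zero)
  parallelPair-coloop₁ (inside ∷ _ ∷ _) 0∉I _ = ⊥-elim (0∉I here)
  parallelPair-coloop₁ (outside ∷ _ ∷ I) _ (_ , I-indep) =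
    refl , subst (Indep K) (sym (∪-identityˡ I)) I-indep

  parallelPair-indep : ∀ (h : Fin 2) → Indep M ⁅ h ↑ˡ n ⁆
  parallelPair-indep zero = refl , indep-∅ K
  parallelPair-indep (suc zero) = refl , indep-∅ K

  private
    image-punchIn-one : ∀ c (X : Subset n) → image (punchIn (suc zero)) (c ∷ X) ≡ c ∷ outside ∷ X
    image-punchIn-one c X = trans (image-punchIn-suc zero c X) (cong (c ∷_) (image-punchIn-zero X))

    ⊥∪-indep : ∀ X → Indep K (⊥ ∪ X) ⇔ Indep K X
    ⊥∪-indep X = subst (λ Y → Indep K Y ⇔ Indep K X) (sym (∪-identityˡ X)) (⇔-id _)

  parallelPair-deletion : ∀ (h : Fin 2) c X →
                          Indep M (image (punchIn (h ↑ˡ n)) (c ∷ X)) ⇔ Indep K X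
  parallelPair-deletion zero c X =
    subst (λ Y → Indep M Y ⇔ Indep K X) (sym (image-punchIn-zero (c ∷ X))) (mk⇔ proj₂ (refl ,_))
  parallelPair-deletion (suc zero) c X =
    subst (λ Y → Indep M Y ⇔ Indep K X) (sym (image-punchIn-one c X)) (mk⇔ proj₂ (∧-zeroʳ c ,_))

  parallelPair-contraction : ∀ (h : Fin 2) c X →
    Indep M (⁅ h ↑ˡ n ⁆ ∪ image (punchIn (h ↑ˡ n)) (c ∷ X)) ⇔ (c ≡ outside × Indep K X)
  parallelPair-contraction zero c X =
    subst (λ Y → Indep M (⁅ zero ⁆ ∪ Y) ⇔ (c ≡ outside × Indep K X)) (sym (image-punchIn-zero (c ∷ X)))
      (⇔-id _ ×-⇔ ⊥∪-indep X)
  parallelPair-contraction (suc zero) c X =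
    subst (λ Y → Indep M (⁅ suc zero ⁆ ∪ Y) ⇔ (c ≡ outside × Indep K X)) (sym (image-punchIn-one c X))
      (mk⇔ (trans (sym (∧-identityʳ c))) (trans (∧-identityʳ c)) ×-⇔ ⊥∪-indep X)

module _ {n} (N : Matroid (suc n)) where

  coloop-zero⇒indep-∷ : IsColoop N zero → ∀ c X → Indep N (c ∷ X) ⇔ Indep (deleteZero N) X
  coloop-zero⇒indep-∷ coloop c X = mk⇔ (indep-↓ N (out⊆ ⊆-refl)) (add c)
    where
    add : ∀ c → Indep N (outside ∷ X) → Indep N (c ∷ X)
    add outside indep = indep
    add inside indep = subst (λ Y → Indep N (inside ∷ Y)) (∪-identityˡ X) (coloop _ indep)

  loop-zero⇒indep-∷ : IsLoop N zero → ∀ c X → Indep N (c ∷ X) ⇔ (c ≡ outside × Indep (deleteZero N) X)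
  loop-zero⇒indep-∷ loop c X = mk⇔ (drop c) (λ { (refl , indep) → indep })
    where
    drop : ∀ c → Indep N (c ∷ X) → c ≡ outside × Indep N (outside ∷ X)
    drop outside indep = refl , indep
    drop inside indep = ⊥-elim (loop (indep-↓ N (in⊆in ⊥⊆) indep))

module _ {n} (N : Matroid (2 + n)) where

  private
    M : Matroid (3 + n)
    M = parallelPair⊕ (deleteZero N)

  parallelPair-minor : IsLoop N zero ⊎ IsColoop N zero →
    ∀ (h : Fin 2) x y → HasMinorUsing N M (punchIn (h ↑ˡ _) x) (punchIn (h ↑ˡ _) y)
  parallelPair-minor (inj₁ loop) h =
    minor-contracting N M _ (parallelPair-indep (deleteZero N) h) λ { (c ∷ X) →
      ⇔-sym (parallelPair-contraction (deleteZero N) h c X) ⇔-∘ loop-zero⇒indep-∷ N loop c X }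
  parallelPair-minor (inj₂ coloop) h =
    minor-deleting N M _ λ { (c ∷ X) →
      ⇔-sym (parallelPair-deletion (deleteZero N) h c X) ⇔-∘ coloop-zero⇒indep-∷ N coloop c X }

  loop⊎coloop⇒nontrivial : HasTransitivity N → IsLoop N zero ⊎ IsColoop N zero →
                            HasNontrivialComponent N
  loop⊎coloop⇒nontrivial transitive degenerate =
    minor-using-parallel-pair {N = N} {M = M} (λ ()) (parallelPair-dependent (deleteZero N))
      (parallelPair-coloop₁ (deleteZero N)) (parallelPair-coloop₀ (deleteZero N))
      (transitive M (suc zero) (suc (suc zero)) zero (λ ()) (λ ()) (λ ())
        (parallelPair-minor degenerate zero zero (suc zero))
        (parallelPair-minor degenerate (suc zero) (suc zero) zero))

corollary6p4 : ∀ {k} (N : Matroid k) → 2 ≤ k → HasTransitivity N →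
    HasNontrivialComponent N
corollary6p4 {suc (suc n)} N (s≤s (s≤s z≤n)) transitive with loop⊎coloop⊎nontrivial N zero
... | inj₁ degenerate = loop⊎coloop⇒nontrivial N transitive degenerate
... | inj₂ nontrivial = nontrivial
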